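{- Let $G=(V,E)$ be a finite undirected graph with $n$ vertices and let $G_1,\dots,G_d$ be pairwise vertex-disjoint subgraphs of $G$ with $n_1,\dots,n_d$ vertices respectively. Then $L^*_{\mathrm{avg}}(G)\ge\frac1n\sum_{i=1}^d n_i\cdot L^*_{\mathrm{avg}}(G_i)$.
   Context: A labeling of a graph $H=(V_H,E_H)$ is a function $L\colon V_H\to 2^{V_H}$. A Customizable Hub Labeling (CuHL) of $H$ satisfies: for any $s,t\in V_H$ and any $s$-$t$-path $P$ in $H$, $L(s)\cap L(t)$ contains a vertex of $P$. $L^*_{\mathrm{avg}}(H)$ denotes the minimum, over all CuHL $L$ of $H$, of the average label size $\frac{1}{|V_H|}\sum_{v\in V_H}|L(v)|$. -}

module Defs where

open import Level using (0ℓ)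
open import Data.Nat using (ℕ; _≤_)
open import Data.Fin using (Fin)
open import Data.Fin.Subset using (Subset; _∈_; _∩_; ∣_∣)
open import Data.List using (List; []; _∷_; map; allFin)
open import Data.Nat.ListAction using (sum)
open import Data.List.Relation.Unary.Any using (Any)
open import Data.List.Relation.Unary.Unique.Propositional using (Unique)
open import Data.Product using (Σ; _×_; ∃)
open import Relation.Binary.PropositionalEquality using (_≡_; _≢_)
open import Relation.Nullary using (¬_)

record Graph (n : ℕ) : Set₁ where
  field
    Adj     : Fin n → Fin n → Set
    sym     : ∀ {u v} → Adj u v → Adj v u
    irrefl  : ∀ {v} → ¬ Adj v v
open Graph public

data Walk {n : ℕ} (G : Graph n) : Fin n → Fin n → List (Fin n) → Set where
  here : ∀ v → Walk G v v (v ∷ [])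
  step : ∀ {u v w vs} → Adj G u v → Walk G v w vs → Walk G u w (u ∷ vs)

IsPath : {n : ℕ} → Graph n → Fin n → Fin n → List (Fin n) → Set
IsPath G s t vs = Walk G s t vs × Unique vs

Labeling : ℕ → Set
Labeling n = Fin n → Subset n

IsCuHL : {n : ℕ} → Graph n → Labeling n → Set
IsCuHL {n} G L = ∀ (s t : Fin n) (P : List (Fin n)) → IsPath G s t P →
  Any (λ v → v ∈ (L s ∩ L t)) P

totalSize : {n : ℕ} → Labeling n → ℕ
totalSize {n} L = sum (map (λ v → ∣ L v ∣) (allFin n))

-- m is the minimum total label size over all CuHLs of G,
-- i.e. m = |V_G| · L*_avg(G).
IsOptTotal : {n : ℕ} → Graph n → ℕ → Set
IsOptTotal G m =
  (Σ (Labeling _) λ L → IsCuHL G L × totalSize L ≡ m) ×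
  (∀ L → IsCuHL G L → m ≤ totalSize L)

record SubgraphOf {m n : ℕ} (H : Graph m) (G : Graph n) : Set where
  field
    emb     : Fin m → Fin n
    inj     : ∀ {x y} → emb x ≡ emb y → x ≡ y
    presAdj : ∀ {x y} → Adj H x y → Adj G (emb x) (emb y)
open SubgraphOf public

sumFin : (d : ℕ) → (Fin d → ℕ) → ℕ
sumFin d f = sum (map f (allFin d))

-- Restricting an optimal CuHL L of G to a subgraph G_i (keep, at each vertex of G_i, only the hubs
-- lying in G_i) gives a CuHL of G_i, since the paths of G_i are paths of G; so the optimum
-- of G_i is at most the total size of L over the vertices of G_i.  Because the G_i are
-- vertex-disjoint, summing over i counts every vertex of G at most once.
module Submission where

open import Defs hiding (sym)
open import Data.Bool using (Bool; true; false; if_then_else_)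
open import Data.Empty using (⊥-elim)
open import Data.Fin using (Fin; zero; suc)
open import Data.Fin.Properties using (_≟_)
import Data.Fin.Properties as Fin
open import Data.Fin.Subset using (Subset; _∩_; ∣_∣) renaming (_∈_ to _∈ₛ_)
open import Data.Fin.Subset.Properties using (x∈p∩q⁺; x∈p∩q⁻)
open import Data.List as List using (allFin)
open import Data.List.Properties using (map-tabulate)
import Data.List.Relation.Unary.Any as Any
open import Data.List.Relation.Unary.Any.Properties using (map⁻)
open import Data.List.Relation.Unary.Unique.Propositional.Properties using (map⁺)
open import Data.Nat using (ℕ; zero; suc; _+_; _*_; _≤_; _<_; z≤n; z<s)
open import Data.Nat.ListAction using (sum)
open import Data.Nat.Properties hiding (_≟_)
open import Data.Product using (∃; _,_; proj₂)
open import Data.Vec using (tabulate; lookup)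
open import Data.Vec.Properties using (tabulate∘lookup; lookup∘tabulate; []=⇒lookup; lookup⇒[]=)
open import Function using (_∘_)
open import Function.Definitions using (Injective)
open import Relation.Binary.PropositionalEquality
open import Relation.Nullary using (yes; no; does)

open import Algebra.Properties.CommutativeMonoid.Sum +-0-commutativeMonoid
  using (sum-syntax; ∑-comm; sum-cong-≗; sum-replicate-zero)
open import Algebra.Properties.Semiring.Sum +-*-semiring using (*-distribʳ-sum)

∑-allFin : ∀ n (f : Fin n → ℕ) → sum (List.map f (allFin n)) ≡ ∑[ i < n ] f i
∑-allFin n f = trans (cong sum (map-tabulate (λ i → i) f)) (sum-tabulate n f)
  where
  sum-tabulate : ∀ n (f : Fin n → ℕ) → sum (List.tabulate f) ≡ ∑[ i < n ] f i
  sum-tabulate zero    f = refl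
  sum-tabulate (suc n) f = cong (f zero +_) (sum-tabulate n (f ∘ suc))

∑-mono-≤ : ∀ n {f g : Fin n → ℕ} → (∀ i → f i ≤ g i) → ∑[ i < n ] f i ≤ ∑[ i < n ] g i
∑-mono-≤ zero    f≤g = z≤n
∑-mono-≤ (suc n) f≤g = +-mono-≤ (f≤g zero) (∑-mono-≤ n (f≤g ∘ suc))

∑-zero : ∀ n {f : Fin n → ℕ} → (∀ i → f i ≡ 0) → ∑[ i < n ] f i ≡ 0
∑-zero n f≡0 = trans (sum-cong-≗ f≡0) (sum-replicate-zero n)

∑-pos : ∀ n (f : Fin n → ℕ) → 0 < ∑[ i < n ] f i → ∃ λ i → 0 < f i
∑-pos (suc n) f ∑f>0 with f zero in eq
... | suc _ = zero , subst (0 <_) (sym eq) z<s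
... | zero with ∑-pos n (f ∘ suc) ∑f>0
...   | i , fi>0 = suc i , fi>0

∑-≤1 : ∀ n (f : Fin n → ℕ) → (∀ i → f i ≤ 1) → (∀ i j → 0 < f i → 0 < f j → i ≡ j) →
       ∑[ i < n ] f i ≤ 1
∑-≤1 zero    f f≤1 unique = z≤n
∑-≤1 (suc n) f f≤1 unique with f zero in eq
... | zero  = ∑-≤1 n (f ∘ suc) (f≤1 ∘ suc) (λ i j p q → Fin.suc-injective (unique (suc i) (suc j) p q))
... | suc k = begin
  suc k + ∑[ i < n ] f (suc i) ≡⟨ cong (suc k +_) (∑-zero n tail≡0) ⟩
  suc k + 0                    ≡⟨ +-identityʳ (suc k) ⟩
  suc k                        ≡⟨ eq ⟨
  f zero                       ≤⟨ f≤1 zero ⟩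
  1                            ∎
  where
  open ≤-Reasoning
  tail≡0 : ∀ i → f (suc i) ≡ 0
  tail≡0 i = n≤0⇒n≡0 (≮⇒≥ (Fin.0≢1+n ∘ unique zero (suc i) (subst (0 <_) (sym eq) z<s)))

χ : Bool → ℕ
χ b = if b then 1 else 0

χ≤1 : ∀ b → χ b ≤ 1
χ≤1 true  = ≤-refl
χ≤1 false = z≤n

δ : ∀ {n} → Fin n → Fin n → ℕ
δ u v = χ (does (u ≟ v))

δ-pos⇒≡ : ∀ {n} (u v : Fin n) → 0 < δ u v → u ≡ v
δ-pos⇒≡ u v δ>0 with u ≟ v
... | yes u≡v = u≡v

∑-δ : ∀ n (f : Fin n → ℕ) w → ∑[ v < n ] (δ w v * f v) ≡ f w
∑-δ (suc n) f zero = begin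
  1 * f zero + ∑[ v < n ] 0 ≡⟨ cong (1 * f zero +_) (∑-zero n (λ _ → refl)) ⟩
  1 * f zero + 0            ≡⟨ +-identityʳ (1 * f zero) ⟩
  1 * f zero                ≡⟨ *-identityˡ (f zero) ⟩
  f zero                    ∎
  where open ≡-Reasoning
∑-δ (suc n) f (suc w) = ∑-δ n (f ∘ suc) w

fibreSize : ∀ {k n} → (Fin k → Fin n) → Fin n → ℕ
fibreSize {k} e v = ∑[ a < k ] δ (e a) v

fibreSize-pos : ∀ {k n} (e : Fin k → Fin n) v → 0 < fibreSize e v → ∃ λ a → e a ≡ v
fibreSize-pos {k} e v size>0 with ∑-pos k (λ a → δ (e a) v) size>0
... | a , δ>0 = a , δ-pos⇒≡ (e a) v δ>0

fibreSize-injective : ∀ {k n} {e : Fin k → Fin n} → Injective _≡_ _≡_ e → ∀ v → fibreSize e v ≤ 1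
fibreSize-injective {k} {e = e} inj v = ∑-≤1 k (λ a → δ (e a) v) (λ a → χ≤1 _)
  (λ a b p q → inj (trans (δ-pos⇒≡ (e a) v p) (sym (δ-pos⇒≡ (e b) v q))))

∑-reindex : ∀ k n (e : Fin k → Fin n) (f : Fin n → ℕ) →
            ∑[ a < k ] f (e a) ≡ ∑[ v < n ] (fibreSize e v * f v)
∑-reindex k n e f = begin
  ∑[ a < k ] f (e a)                     ≡⟨ sum-cong-≗ (λ a → ∑-δ n f (e a)) ⟨
  ∑[ a < k ] ∑[ v < n ] (δ (e a) v * f v)  ≡⟨ ∑-comm (λ a v → δ (e a) v * f v) ⟩
  ∑[ v < n ] ∑[ a < k ] (δ (e a) v * f v)  ≡⟨ sum-cong-≗ (λ v → *-distribʳ-sum (f v) (λ a → δ (e a) v)) ⟨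
  ∑[ v < n ] (fibreSize e v * f v)         ∎
  where open ≡-Reasoning

∑-weighted-≤ : ∀ n (w f : Fin n → ℕ) → (∀ v → w v ≤ 1) → ∑[ v < n ] (w v * f v) ≤ ∑[ v < n ] f v
∑-weighted-≤ n w f w≤1 = ∑-mono-≤ n λ v → ≤-trans (*-monoˡ-≤ (f v) (w≤1 v)) (≤-reflexive (*-identityˡ (f v)))

∑-injective-≤ : ∀ k n {e : Fin k → Fin n} → Injective _≡_ _≡_ e → (f : Fin n → ℕ) →
                ∑[ a < k ] f (e a) ≤ ∑[ v < n ] f v
∑-injective-≤ k n {e} inj f = begin
  ∑[ a < k ] f (e a)             ≡⟨ ∑-reindex k n e f ⟩
  ∑[ v < n ] (fibreSize e v * f v) ≤⟨ ∑-weighted-≤ n (fibreSize e) f (fibreSize-injective inj) ⟩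
  ∑[ v < n ] f v                 ∎
  where open ≤-Reasoning

∑-disjoint-injective-≤ : ∀ d (k : Fin d → ℕ) n (e : (i : Fin d) → Fin (k i) → Fin n) →
  (∀ i → Injective _≡_ _≡_ (e i)) → (∀ i j → i ≢ j → ∀ x y → e i x ≢ e j y) → (f : Fin n → ℕ) →
  ∑[ i < d ] ∑[ x < k i ] f (e i x) ≤ ∑[ v < n ] f v
∑-disjoint-injective-≤ d k n e inj disj f = begin
  ∑[ i < d ] ∑[ x < k i ] f (e i x)               ≡⟨ sum-cong-≗ (λ i → ∑-reindex (k i) n (e i) f) ⟩
  ∑[ i < d ] ∑[ v < n ] (fibreSize (e i) v * f v)   ≡⟨ ∑-comm (λ i v → fibreSize (e i) v * f v) ⟩
  ∑[ v < n ] ∑[ i < d ] (fibreSize (e i) v * f v)   ≡⟨ sum-cong-≗ (λ v → *-distribʳ-sum (f v) (λ i → fibreSize (e i) v)) ⟨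
  ∑[ v < n ] ((∑[ i < d ] fibreSize (e i) v) * f v) ≤⟨ ∑-weighted-≤ n _ f multiplicity≤1 ⟩
  ∑[ v < n ] f v                                  ∎
  where
  open ≤-Reasoning
  multiplicity≤1 : ∀ v → ∑[ i < d ] fibreSize (e i) v ≤ 1
  multiplicity≤1 v = ∑-≤1 d (λ i → fibreSize (e i) v) (λ i → fibreSize-injective (inj i) v) unique
    where
    unique : ∀ i j → 0 < fibreSize (e i) v → 0 < fibreSize (e j) v → i ≡ j
    unique i j p q with i ≟ j | fibreSize-pos (e i) v p | fibreSize-pos (e j) v q
    ... | yes i≡j | _ | _ = i≡j
    ... | no i≢j | x , eix≡v | y , ejy≡v = ⊥-elim (disj i j i≢j x y (trans eix≡v (sym ejy≡v)))

∣tabulate∣ : ∀ n (g : Fin n → Bool) → ∣ tabulate g ∣ ≡ ∑[ v < n ] χ (g v)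
∣tabulate∣ zero    g = refl
∣tabulate∣ (suc n) g with g zero
... | true  = cong suc (∣tabulate∣ n (g ∘ suc))
... | false = ∣tabulate∣ n (g ∘ suc)

∣p∣≡∑χ : ∀ n (p : Subset n) → ∣ p ∣ ≡ ∑[ v < n ] χ (lookup p v)
∣p∣≡∑χ n p = trans (cong ∣_∣ (sym (tabulate∘lookup p))) (∣tabulate∣ n (lookup p))

preimage : ∀ {m n} → (Fin m → Fin n) → Subset n → Subset m
preimage e p = tabulate (lookup p ∘ e)

∈-preimage⁺ : ∀ {m n} (e : Fin m → Fin n) {p : Subset n} {x} → e x ∈ₛ p → x ∈ₛ preimage e p
∈-preimage⁺ e {p} {x} ex∈p =
  lookup⇒[]= x (preimage e p) (trans (lookup∘tabulate (lookup p ∘ e) x) ([]=⇒lookup ex∈p))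

∣preimage∣≤ : ∀ {m n} {e : Fin m → Fin n} → Injective _≡_ _≡_ e → ∀ p → ∣ preimage e p ∣ ≤ ∣ p ∣
∣preimage∣≤ {m} {n} {e} inj p = begin
  ∣ preimage e p ∣              ≡⟨ ∣tabulate∣ m (lookup p ∘ e) ⟩
  ∑[ x < m ] χ (lookup p (e x)) ≤⟨ ∑-injective-≤ m n inj (χ ∘ lookup p) ⟩
  ∑[ v < n ] χ (lookup p v)     ≡⟨ ∣p∣≡∑χ n p ⟨
  ∣ p ∣                         ∎
  where open ≤-Reasoning

module _ {m n} {H : Graph m} {G : Graph n} (H⊆G : SubgraphOf H G) where

  private
    e = emb H⊆G

  restrict : Labeling n → Labeling m
  restrict L x = preimage e (L (e x))

  map-walk : ∀ {s t P} → Walk H s t P → Walk G (e s) (e t) (List.map e P)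
  map-walk (here v)      = here (e v)
  map-walk (step uv vwP) = step (presAdj H⊆G uv) (map-walk vwP)

  map-path : ∀ {s t P} → IsPath H s t P → IsPath G (e s) (e t) (List.map e P)
  map-path (walk , unique) = map-walk walk , map⁺ (inj H⊆G) unique

  restrict-isCuHL : ∀ L → IsCuHL G L → IsCuHL H (restrict L)
  restrict-isCuHL L cuhl s t P path =
    Any.map pull (map⁻ (cuhl (e s) (e t) (List.map e P) (map-path path)))
    where
    pull : ∀ {y} → e y ∈ₛ L (e s) ∩ L (e t) → y ∈ₛ restrict L s ∩ restrict L t
    pull ey∈ with x∈p∩q⁻ (L (e s)) (L (e t)) ey∈
    ... | ey∈Ls , ey∈Lt = x∈p∩q⁺ (∈-preimage⁺ e ey∈Ls , ∈-preimage⁺ e ey∈Lt)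

  totalSize-restrict : ∀ L → totalSize (restrict L) ≤ ∑[ x < m ] ∣ L (e x) ∣
  totalSize-restrict L = begin
    totalSize (restrict L)         ≡⟨ ∑-allFin m (∣_∣ ∘ restrict L) ⟩
    ∑[ x < m ] ∣ restrict L x ∣    ≤⟨ ∑-mono-≤ m (λ x → ∣preimage∣≤ (inj H⊆G) (L (e x))) ⟩
    ∑[ x < m ] ∣ L (e x) ∣         ∎
    where open ≤-Reasoning

mainTheorem10 : (n : ℕ) (G : Graph n) (d : ℕ) (ns : Fin d → ℕ)
    (Gs : (i : Fin d) → Graph (ns i))
    (sub : (i : Fin d) → SubgraphOf (Gs i) G)
    (disj : ∀ i j → i ≢ j → ∀ x y → emb (sub i) x ≢ emb (sub j) y)
    (m : ℕ) (ms : Fin d → ℕ) →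
    IsOptTotal G m → (∀ i → IsOptTotal (Gs i) (ms i)) →
    sumFin d ms ≤ m
mainTheorem10 n G d ns Gs sub disj m ms ((L , cuhl , size≡m) , _) opts = begin
  sumFin d ms                                   ≡⟨ ∑-allFin d ms ⟩
  ∑[ i < d ] ms i                               ≤⟨ ∑-mono-≤ d restriction-bound ⟩
  ∑[ i < d ] ∑[ x < ns i ] ∣ L (emb (sub i) x) ∣ ≤⟨ ∑-disjoint-injective-≤ d ns n (emb ∘ sub) (inj ∘ sub) disj (∣_∣ ∘ L) ⟩
  ∑[ v < n ] ∣ L v ∣                            ≡⟨ ∑-allFin n (∣_∣ ∘ L) ⟨
  totalSize L                                   ≡⟨ size≡m ⟩
  m                                             ∎
  where
  open ≤-Reasoning
  restriction-bound : ∀ i → ms i ≤ ∑[ x < ns i ] ∣ L (emb (sub i) x) ∣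
  restriction-bound i = ≤-trans (proj₂ (opts i) (restrict (sub i) L) (restrict-isCuHL (sub i) L cuhl))
                                (totalSize-restrict (sub i) L)
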